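{- Let $n\ge 2$, write $VQ_n=L\odot R$, let $H\in\{L,R\}$ and let $x,y$ be vertices of $H$. Then $d_H(x,y)=d_{VQ_n}(x,y)$.
   Context: The $n$-dimensional varietal hypercube $VQ_n$ is defined recursively on the vertex set of binary strings of length $n$. $VQ_1$ is the complete graph on the two vertices $0$ and $1$. For $n>1$, let $VQ^0_{n-1}$ (resp. $VQ^1_{n-1}$) be the graph obtained from $VQ_{n-1}$ by prefixing $0$ (resp. $1$) to every vertex label. $VQ_n$ consists of $VQ^0_{n-1}$ and $VQ^1_{n-1}$ together with the following edges: a vertex $x=0x_{n-1}\cdots x_1$ and a vertex $y=1y_{n-1}\cdots y_1$ are adjacent if and only if either (1) $n$ is not a multiple of $3$ and $x_{n-1}\cdots x_1=y_{n-1}\cdots y_1$, or (2) $n$ is a multiple of $3$, $x_{n-3}\cdots x_1=y_{n-3}\cdots y_1$ and $(x_{n-1}x_{n-2},y_{n-1}y_{n-2})\in\{(00,00),(01,01),(10,11),(11,10)\}$. We write $VQ_n=L\odot R$ with $L=VQ^0_{n-1}$ and $R=VQ^1_{n-1}$ (as subgraphs of $VQ_n$). $d_G(u,v)$ denotes the distance between $u$ and $v$ in the graph $G$. -}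

module Defs where

open import Data.Nat using (ℕ; zero; suc; _≤_)
open import Data.Nat.Divisibility using (_∣_)
open import Data.Bool using (Bool; true; false)
open import Data.Vec using (Vec; []; _∷_)
open import Data.Product using (_×_)
open import Relation.Nullary using (¬_)
open import Relation.Binary.PropositionalEquality using (_≡_)

-- A vertex of VQ_n is a binary string x_n x_{n-1} ... x_1, represented as
-- Vec Bool n with the head being x_n (false = 0, true = 1).

data PairOK : Bool → Bool → Bool → Bool → Set where
  p00-00 : PairOK false false false false
  p01-01 : PairOK false true  false true
  p10-11 : PairOK true  false true  true
  p11-10 : PairOK true  true  true  false

Cross3 : {m : ℕ} → Vec Bool m → Vec Bool m → Set
Cross3 (x₁ ∷ x₂ ∷ xs) (y₁ ∷ y₂ ∷ ys) = (xs ≡ ys) × PairOK x₁ x₂ y₁ y₂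
Cross3 _ _ = Data.Empty.⊥
  where import Data.Empty

Cross : (m : ℕ) → Vec Bool m → Vec Bool m → Set
Cross m x y = (¬ (3 ∣ suc m) → x ≡ y) × (3 ∣ suc m → Cross3 x y)

-- Adjacency in VQ_n (VQ_0 is the single vertex with no edges, so VQ_1 = K_2).
data Adj : (n : ℕ) → Vec Bool n → Vec Bool n → Set where
  inner : ∀ {m} (a : Bool) {x y : Vec Bool m} → Adj m x y → Adj (suc m) (a ∷ x) (a ∷ y)
  cross01 : ∀ {m} {x y : Vec Bool m} → Cross m x y → Adj (suc m) (false ∷ x) (true ∷ y)
  cross10 : ∀ {m} {x y : Vec Bool m} → Cross m x y → Adj (suc m) (true ∷ y) (false ∷ x)

data Walk {V : Set} (E : V → V → Set) : V → V → ℕ → Set where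
  here : ∀ {u} → Walk E u u 0
  step : ∀ {u v w k} → E u v → Walk E v w k → Walk E u w (suc k)

Dist : {V : Set} (E : V → V → Set) → V → V → ℕ → Set
Dist E u v d = Walk E u v d × (∀ k → Walk E u v k → d ≤ k)

VQ : (n : ℕ) → Vec Bool n → Vec Bool n → Set
VQ n = Adj n

-- The subgraph H = VQ^b_{n-1} of VQ_{suc m} induced on vertices with first bit b
-- (b = false gives L, b = true gives R); vertices are identified with their suffix.
Half : (m : ℕ) (b : Bool) → Vec Bool m → Vec Bool m → Set
Half m b x y = Adj (suc m) (b ∷ x) (b ∷ y)

module Submission where

-- A subgraph H of a graph G is isometric as soon as H is a
-- retract of G in the weak sense: there is a graph homomorphism f : H → G
-- and a map r : G → H with r ∘ f = id that sends every edge of G either to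
-- an edge of H or collapses it to a single vertex.  Indeed f copies walks
-- of H into G without changing their length, and r shortens walks of G
-- into walks of H, so both graphs have the same shortest walks.
--
-- For VQ_{m+1} = L ⊙ R and H = VQ^b_m, take f = (b ∷_) and r = tail (drop
-- the leading bit).  The only non-trivial point is that r weakly preserves
-- edges: an inner edge of VQ_{m+1} is an edge of VQ_m, and a cross edge
-- 0x ~ 1y either has x = y or (when 3 ∣ m+1 and the leading pair is
-- 10/11) joins x = 10z and y = 11z, which are adjacent in VQ_m through a
-- cross edge of its sub-cube VQ_{m-1}, since then 3 ∤ m-1.

open import Defs
open import Data.Nat using (ℕ; suc; _+_; _≤_; z≤n; s≤s)
open import Data.Nat.Properties using (≤-trans; ≤-antisym; n≤1+n; +-comm)
open import Data.Nat.Divisibility using (_∣_; _∣?_; ∣m+n∣m⇒∣n; ∣⇒≤)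
open import Data.Bool using (Bool; true; false)
open import Data.Vec using (Vec; _∷_; tail)
open import Data.Product using (_×_; _,_; Σ)
open import Data.Sum using (_⊎_; inj₁; inj₂)
open import Data.Empty using (⊥-elim)
open import Relation.Nullary using (¬_; yes; no)
open import Relation.Binary.PropositionalEquality using (_≡_; refl; sym; subst; subst₂)
open import Function.Bundles using (_⇔_; mk⇔)

WalkWithin : {V : Set} (E : V → V → Set) → V → V → ℕ → Set
WalkWithin E u v k = Σ ℕ λ k′ → k′ ≤ k × Walk E u v k′

module _ {V W : Set} {E : V → V → Set} {F : W → W → Set} where

  map-walk : (f : V → W) → (∀ {u v} → E u v → F (f u) (f v))
           → ∀ {u v k} → Walk E u v k → Walk F (f u) (f v) k
  map-walk f hom here       = here
  map-walk f hom (step e w) = step (hom e) (map-walk f hom w)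

  contract-walk : (r : W → V) → (∀ {u v} → F u v → r u ≡ r v ⊎ E (r u) (r v))
                → ∀ {u v k} → Walk F u v k → WalkWithin E (r u) (r v) k
  contract-walk r weak here = 0 , z≤n , here
  contract-walk r weak {v = t} (step e w) with contract-walk r weak w | weak e
  ... | k′ , k′≤k , w′ | inj₁ ru≡rv =
        k′ , ≤-trans k′≤k (n≤1+n _) , subst (λ a → Walk E a (r t) k′) (sym ru≡rv) w′
  ... | k′ , k′≤k , w′ | inj₂ e′ = suc k′ , s≤s k′≤k , step e′ w′

  retract-isometric : (f : V → W) (r : W → V)
    → (∀ {u v} → E u v → F (f u) (f v))
    → (∀ {u v} → F u v → r u ≡ r v ⊎ E (r u) (r v))
    → (∀ x → r (f x) ≡ x)
    → ∀ x y d → Dist E x y d ⇔ Dist F (f x) (f y) d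
  retract-isometric f r hom weak retract x y d = mk⇔ to from
    where
    pull : ∀ {k} → Walk F (f x) (f y) k → WalkWithin E x y k
    pull w with contract-walk r weak w
    ... | k′ , k′≤k , w′ = k′ , k′≤k , subst₂ (λ a b → Walk E a b k′) (retract x) (retract y) w′

    to : Dist E x y d → Dist F (f x) (f y) d
    to (w , shortest) = map-walk f hom w , λ k w₂ → let (k′ , k′≤k , w′) = pull w₂ in
                                                    ≤-trans (shortest k′ w′) k′≤k

    from : Dist F (f x) (f y) d → Dist E x y d
    from (w , shortest) with pull w
    ... | k′ , k′≤d , w′ =
          subst (Walk E x y) (≤-antisym k′≤d (shortest k′ (map-walk f hom w′))) w′
        , λ k w₂ → shortest k (map-walk f hom w₂)

Adj-sym : ∀ {n} {x y : Vec Bool n} → Adj n x y → Adj n y x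
Adj-sym (inner a e) = inner a (Adj-sym e)
Adj-sym (cross01 c) = cross10 c
Adj-sym (cross10 c) = cross01 c

three∤-two-below : ∀ k → 3 ∣ suc (suc (suc k)) → ¬ 3 ∣ suc k
three∤-two-below k 3∣k+3 3∣k+1 = three∤two (∣m+n∣m⇒∣n 3∣k+1+2 3∣k+1)
  where
  3∣k+1+2 : 3 ∣ suc k + 2
  3∣k+1+2 = subst (3 ∣_) (+-comm 2 (suc k)) 3∣k+3

  three∤two : ¬ 3 ∣ 2
  three∤two 3∣2 with ∣⇒≤ 3∣2
  ... | s≤s (s≤s ())

straight : ∀ k (z : Vec Bool k) → ¬ 3 ∣ suc k → Cross k z z
straight k z 3∤k+1 = (λ _ → refl) , (λ 3∣k+1 → ⊥-elim (3∤k+1 3∣k+1))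

-- When 3 ∣ m+1, the ends of a cross edge of VQ_{m+1} have suffixes that
-- agree (pairs 00/00, 01/01) or are adjacent in VQ_m (pairs 10/11, 11/10):
-- the words 10z and 11z are joined by a cross edge of VQ_{m-1}, whose
-- dimension m-1 is not a multiple of 3.
cross3-suffixes : ∀ {m} {x y : Vec Bool m} → 3 ∣ suc m → Cross3 x y → x ≡ y ⊎ Adj m x y
cross3-suffixes {x = false ∷ false ∷ _} {y = _ ∷ _ ∷ _} _ (refl , p00-00) = inj₁ refl
cross3-suffixes {x = false ∷ true ∷ _}  {y = _ ∷ _ ∷ _} _ (refl , p01-01) = inj₁ refl
cross3-suffixes {suc (suc k)} {x = true ∷ false ∷ z} {y = _ ∷ _ ∷ _} 3∣m+1 (refl , p10-11) =
  inj₂ (inner true (cross01 (straight k z (three∤-two-below k 3∣m+1))))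
cross3-suffixes {suc (suc k)} {x = true ∷ true ∷ z} {y = _ ∷ _ ∷ _} 3∣m+1 (refl , p11-10) =
  inj₂ (inner true (cross10 (straight k z (three∤-two-below k 3∣m+1))))

cross-suffixes : ∀ {m} {x y : Vec Bool m} → Cross m x y → x ≡ y ⊎ Adj m x y
cross-suffixes {m} (if3∤ , if3∣) with 3 ∣? suc m
... | yes 3∣m+1 = cross3-suffixes 3∣m+1 (if3∣ 3∣m+1)
... | no 3∤m+1  = inj₁ (if3∤ 3∤m+1)

tail-edge : ∀ {m} {u v : Vec Bool (suc m)} → Adj (suc m) u v
          → tail u ≡ tail v ⊎ Adj m (tail u) (tail v)
tail-edge (inner a e) = inj₂ e
tail-edge (cross01 c) = cross-suffixes c
tail-edge (cross10 c) with cross-suffixes c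
... | inj₁ x≡y = inj₁ (sym x≡y)
... | inj₂ e   = inj₂ (Adj-sym e)

-- H = VQ^b_m is a weak retract of VQ_{m+1} via (b ∷_) and tail; the
-- argument also covers m = 0.
corollary2p9 : (m : ℕ) → 1 ≤ m → (b : Bool) → (x y : Vec Bool m) → (d : ℕ)
    → Dist (Half m b) x y d ⇔ Dist (VQ (suc m)) (b ∷ x) (b ∷ y) d
corollary2p9 m _ b = retract-isometric (b ∷_) tail (λ e → e) tail-edge-in-half (λ _ → refl)
  where
  tail-edge-in-half : ∀ {u v} → Adj (suc m) u v → tail u ≡ tail v ⊎ Half m b (tail u) (tail v)
  tail-edge-in-half e with tail-edge e
  ... | inj₁ collapsed = inj₁ collapsed
  ... | inj₂ e′        = inj₂ (inner b e′)
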